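{- For $n\ge1$, \[\sum_{\alpha\in\mathrm{FR}_n^{\uparrow}} q^{\mathrm{lucky}(\alpha)}=q(q+1)^{n-1},\] and for $n=0$ this sum equals $1$.
   Context: $\mathrm{FR}_n^{\uparrow}$ is the set of weakly increasing Fubini rankings with $n$ competitors: tuples $\alpha=(a_1,\ldots,a_n)\in\{1,\ldots,n\}^n$ with $a_1\le\cdots\le a_n$ and $a_i=1+|\{j:a_j<a_i\}|$ for every $i$ ($\mathrm{FR}_0^{\uparrow}$ contains only the empty ranking). $\mathrm{lucky}(\alpha)$ is the number of lucky cars: cars $1,\ldots,n$ enter in order a one-way street with spots $1,\ldots,n$, car $i$ parks at spot $a_i$ if free, else at the first free spot after $a_i$, and is lucky if it parks at $a_i$. -}

module Defs where

open import Data.Nat using (ℕ; zero; suc; _+_; _*_; _^_; _∸_; _≡ᵇ_; _<ᵇ_; _≤ᵇ_)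
open import Data.Bool using (Bool; true; false; _∧_; if_then_else_; not)
open import Data.List using (List; []; _∷_; map; concatMap; filter; length; applyUpTo)
open import Data.Nat.ListAction using (sum)
open import Data.Bool.ListAction using (any; all)
open import Data.List.Relation.Unary.All using (All)
open import Relation.Binary.PropositionalEquality using (_≡_)
open import Relation.Nullary.Decidable using (Dec)
open import Data.Bool.Properties using (T?)
open import Data.Bool using (T)

range1 : ℕ → List ℕ
range1 n = applyUpTo suc n

tuples : ℕ → ℕ → List (List ℕ)
tuples n zero    = [] ∷ []
tuples n (suc k) = concatMap (λ a → map (a ∷_) (tuples n k)) (range1 n)

weaklyIncreasing : List ℕ → Bool
weaklyIncreasing []           = true
weaklyIncreasing (a ∷ [])     = true
weaklyIncreasing (a ∷ b ∷ xs) = (a ≤ᵇ b) ∧ weaklyIncreasing (b ∷ xs)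

countBelow : List ℕ → ℕ → ℕ
countBelow α x = length (filter (λ y → T? (y <ᵇ x)) α)

isFubini : List ℕ → Bool
isFubini α = all (λ a → a ≡ᵇ suc (countBelow α a)) α

FRup : ℕ → List (List ℕ)
FRup n = filter (λ α → T? (weaklyIncreasing α ∧ isFubini α)) (tuples n n)

occupied : List ℕ → ℕ → Bool
occupied occ s = any (s ≡ᵇ_) occ

firstFree : List ℕ → ℕ → ℕ → ℕ
firstFree occ s zero       = s
firstFree occ s (suc fuel) = if occupied occ s then firstFree occ (suc s) fuel else s

luckyAux : ℕ → List ℕ → List ℕ → ℕ
luckyAux n occ []      = 0
luckyAux n occ (a ∷ α) =
  if occupied occ a
  then luckyAux n (firstFree occ a n ∷ occ) α
  else suc (luckyAux n (a ∷ occ) α)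

lucky : List ℕ → ℕ
lucky α = luckyAux (length α) [] α

luckyPoly : ℕ → ℕ → ℕ
luckyPoly n q = sum (map (λ α → q ^ lucky α) (FRup n))

{-# OPTIONS --safe #-}
-- A weakly increasing ranking is Fubini exactly when it starts with 1 and every later
-- entry either repeats its predecessor or equals its own position i + 1 (it opens a new
-- block of ties).  When such a ranking parks, the first i cars fill spots inside 1..i, so a
-- car opening a block finds spot i + 1 free and is lucky, while a car repeating a value
-- finds its spot taken.  The first car is always lucky and each of the n - 1 later cars
-- independently contributes 1 (repeat) or q (new block), whence q (q + 1) ^ (n - 1).
module Submission where

open import Defs
open import Data.Nat using (ℕ; zero; suc; _+_; _*_; _^_; _≤_; _<_; z≤n; s≤s; _≡ᵇ_; _<ᵇ_)
open import Data.Nat.Properties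
  using (≡ᵇ⇒≡; ≡⇒≡ᵇ; <ᵇ⇒<; <⇒<ᵇ; ≤ᵇ⇒≤; ≤⇒≤ᵇ; ≤-refl; ≤-trans; ≤-<-trans; <⇒≤; <⇒≢; <⇒≱;
         m≤n⇒m≤1+n; m≤n⇒m<n∨m≡n; m+n≤o⇒m≤o; +-suc; +-comm; +-assoc; +-identityʳ;
         *-zeroʳ; *-distribˡ-+)
open import Data.Nat.ListAction using (sum)
open import Data.Nat.ListAction.Properties using (sum-++)
open import Data.Bool using (Bool; true; false; T; _∧_; _∨_; if_then_else_)
open import Data.Bool.Properties using (T?; T-≡; T-∧; T-∨)
open import Data.Bool.ListAction using (and; all)
open import Data.List using (List; []; _∷_; _++_; map; concatMap; filter; length)
open import Data.List.Properties
  using (map-cong; map-cong-local; map-∘; map-++; filter-++; filter-none; filter-accept; length-++)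
open import Data.List.Membership.Propositional using (_∈_)
open import Data.List.Membership.Propositional.Properties using (∈-applyUpTo⁺)
open import Data.List.Relation.Unary.All as All using (All; []; _∷_)
open import Data.List.Relation.Unary.All.Properties using (concat⁺; map⁺; applyUpTo⁺₂)
open import Data.List.Relation.Unary.Any using (here; there)
open import Data.List.Relation.Unary.Unique.Propositional using (Unique; []; _∷_)
import Data.List.Relation.Unary.Unique.Propositional.Properties as Unique
open import Data.Product using (_×_; _,_; proj₁; proj₂)
open import Data.Sum as Sum using (_⊎_; inj₁; inj₂)
open import Function using (_∘_; Equivalence; _⇔_; mk⇔)
open import Level using (Level)
open import Relation.Binary.PropositionalEquality
open import Relation.Nullary using (¬_; contradiction)

open Equivalence using (to; from)

private
  variable
    ℓ : Level
    A : Set ℓ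

T-⇔⇒≡ : ∀ {x y : Bool} → (T x → T y) → (T y → T x) → x ≡ y
T-⇔⇒≡ {false} {false} _ _ = refl
T-⇔⇒≡ {false} {true}  _ g = contradiction _ g
T-⇔⇒≡ {true}  {false} f _ = contradiction _ f
T-⇔⇒≡ {true}  {true}  _ _ = refl

¬T⇒≡false : ∀ {x} → ¬ T x → x ≡ false
¬T⇒≡false {false} _  = refl
¬T⇒≡false {true}  ¬t = contradiction _ ¬t

≡ᵇ-refl : ∀ n → (n ≡ᵇ n) ≡ true
≡ᵇ-refl n = to T-≡ (≡⇒≡ᵇ n n refl)

≢⇒≡ᵇ≡false : ∀ {m n} → m ≢ n → (m ≡ᵇ n) ≡ false
≢⇒≡ᵇ≡false {m} {n} m≢n = ¬T⇒≡false (m≢n ∘ ≡ᵇ⇒≡ m n)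

sum-map-filter : (P : A → Bool) (f : A → ℕ) (xs : List A) →
                 sum (map f (filter (λ x → T? (P x)) xs)) ≡ sum (map (λ x → if P x then f x else 0) xs)
sum-map-filter P f []       = refl
sum-map-filter P f (x ∷ xs) with P x
... | true  = cong (f x +_) (sum-map-filter P f xs)
... | false = sum-map-filter P f xs

sum-map-concatMap : ∀ {B : Set ℓ} (g : B → ℕ) (h : A → List B) (xs : List A) →
                    sum (map g (concatMap h xs)) ≡ sum (map (λ x → sum (map g (h x))) xs)
sum-map-concatMap g h []       = refl
sum-map-concatMap g h (x ∷ xs) = begin
  sum (map g (h x ++ concatMap h xs))               ≡⟨ cong sum (map-++ g (h x) _) ⟩
  sum (map g (h x) ++ map g (concatMap h xs))       ≡⟨ sum-++ (map g (h x)) _ ⟩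
  sum (map g (h x)) + sum (map g (concatMap h xs))  ≡⟨ cong (_ +_) (sum-map-concatMap g h xs) ⟩
  _                                                 ∎
  where open ≡-Reasoning

sum-map-*ˡ : ∀ c (f : A → ℕ) xs → sum (map (λ x → c * f x) xs) ≡ c * sum (map f xs)
sum-map-*ˡ c f []       = sym (*-zeroʳ c)
sum-map-*ˡ c f (x ∷ xs) =
  trans (cong (c * f x +_) (sum-map-*ˡ c f xs)) (sym (*-distribˡ-+ c (f x) _))

sum-map-zero : ∀ {f : A → ℕ} {xs} → All (λ x → f x ≡ 0) xs → sum (map f xs) ≡ 0
sum-map-zero []            = refl
sum-map-zero (fx≡0 ∷ rest) = cong₂ _+_ fx≡0 (sum-map-zero rest)

sum-map-onePoint : ∀ {f : A → ℕ} {xs c} → Unique xs → c ∈ xs →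
                   (∀ {b} → b ∈ xs → b ≢ c → f b ≡ 0) → sum (map f xs) ≡ f c
sum-map-onePoint {f = f} (c∉xs ∷ _) (here refl) vanish =
  trans (cong (f _ +_) (sum-map-zero (All.tabulate λ b∈xs → vanish (there b∈xs) (≢-sym (All.lookup c∉xs b∈xs)))))
        (+-identityʳ _)
sum-map-onePoint (x∉xs ∷ u) (there c∈xs) vanish =
  cong₂ _+_ (vanish (here refl) (All.lookup x∉xs c∈xs)) (sum-map-onePoint u c∈xs (vanish ∘ there))

sum-map-twoPoints : ∀ {f : A → ℕ} {xs c d} → Unique xs → c ∈ xs → d ∈ xs → c ≢ d →
                    (∀ {b} → b ∈ xs → b ≢ c → b ≢ d → f b ≡ 0) → sum (map f xs) ≡ f c + f d
sum-map-twoPoints _ (here refl) (here refl) c≢d _ = contradiction refl c≢d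
sum-map-twoPoints {f = f} (c∉xs ∷ u) (here refl) (there d∈xs) _ vanish =
  cong (f _ +_) (sum-map-onePoint u d∈xs λ b∈xs → vanish (there b∈xs) (≢-sym (All.lookup c∉xs b∈xs)))
sum-map-twoPoints {f = f} {c = c} {d} (d∉xs ∷ u) (there c∈xs) (here refl) _ vanish =
  trans (cong (f d +_) (sum-map-onePoint u c∈xs λ b∈xs b≢c → vanish (there b∈xs) b≢c (≢-sym (All.lookup d∉xs b∈xs))))
        (+-comm (f d) (f c))
sum-map-twoPoints (x∉xs ∷ u) (there c∈xs) (there d∈xs) c≢d vanish =
  cong₂ _+_ (vanish (here refl) (All.lookup x∉xs c∈xs) (All.lookup x∉xs d∈xs))
            (sum-map-twoPoints u c∈xs d∈xs c≢d (vanish ∘ there))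

range1-unique : ∀ m → Unique (range1 m)
range1-unique m = Unique.applyUpTo⁺₁ suc m (λ i<j _ → <⇒≢ (s≤s i<j))

∈-range1 : ∀ {c m} → 1 ≤ c → c ≤ m → c ∈ range1 m
∈-range1 {suc c} _ c<m = ∈-applyUpTo⁺ suc c<m

tuples-length : ∀ m k → All (λ t → length t ≡ k) (tuples m k)
tuples-length m zero    = refl ∷ []
tuples-length m (suc k) =
  concat⁺ (map⁺ (applyUpTo⁺₂ suc m λ _ → map⁺ (All.map (cong suc) (tuples-length m k))))

sum-map-tuples : ∀ m k (g : List ℕ → ℕ) →
                 sum (map g (tuples m (suc k))) ≡ sum (map (λ a → sum (map (g ∘ (a ∷_)) (tuples m k))) (range1 m))
sum-map-tuples m k g =
  trans (sum-map-concatMap g (λ a → map (a ∷_) (tuples m k)) (range1 m))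
        (cong sum (map-cong (λ a → cong sum (sym (map-∘ (tuples m k)))) (range1 m)))

-- staircaseFrom i p t: t continues a ranking whose first i entries end with p, each new
-- entry either repeating its predecessor or equal to its own (1-based) position.
staircaseFrom : ℕ → ℕ → List ℕ → Bool
staircaseFrom i p []      = true
staircaseFrom i p (b ∷ t) = ((b ≡ᵇ p) ∨ (b ≡ᵇ suc i)) ∧ staircaseFrom (suc i) b t

staircase : List ℕ → Bool
staircase []      = true
staircase (a ∷ t) = (a ≡ᵇ 1) ∧ staircaseFrom 1 1 t

countBelow-∷ : ∀ b γ a → countBelow (b ∷ γ) a ≡ countBelow (b ∷ []) a + countBelow γ a
countBelow-∷ b γ a =
  trans (cong length (filter-++ (λ y → T? (y <ᵇ a)) (b ∷ []) γ)) (length-++ (filter (λ y → T? (y <ᵇ a)) (b ∷ [])))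

countBelow-none : ∀ {x} γ → All (x ≤_) γ → countBelow γ x ≡ 0
countBelow-none {x} γ x≤γ =
  cong length (filter-none (λ y → T? (y <ᵇ x)) (All.map (λ x≤y y<x → <⇒≱ (<ᵇ⇒< _ x y<x) x≤y) x≤γ))

countBelow-[]-< : ∀ {b a} → b < a → countBelow (b ∷ []) a ≡ 1
countBelow-[]-< {a = a} b<a = cong length (filter-accept (λ y → T? (y <ᵇ a)) (<⇒<ᵇ b<a))

weaklyIncreasing⇒head≤ : ∀ b γ → T (weaklyIncreasing (b ∷ γ)) → All (b ≤_) γ
weaklyIncreasing⇒head≤ b []      _ = []
weaklyIncreasing⇒head≤ b (c ∷ γ) w =
  let b≤c , w′ = to T-∧ w
  in ≤ᵇ⇒≤ b c b≤c ∷ All.map (≤-trans (≤ᵇ⇒≤ b c b≤c)) (weaklyIncreasing⇒head≤ c γ w′)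

T-weaklyIncreasing-∷ : ∀ p b γ → T (weaklyIncreasing (p ∷ b ∷ γ)) ⇔ (p ≤ b × T (weaklyIncreasing (b ∷ γ)))
T-weaklyIncreasing-∷ p b γ =
  mk⇔ (λ w → let p≤b , w′ = to T-∧ w in ≤ᵇ⇒≤ p b p≤b , w′)
      (λ (p≤b , w′) → from T-∧ (≤⇒≤ᵇ p≤b , w′))

T-staircaseFrom-∷ : ∀ i p b t →
                    T (staircaseFrom i p (b ∷ t)) ⇔ ((b ≡ p ⊎ b ≡ suc i) × T (staircaseFrom (suc i) b t))
T-staircaseFrom-∷ i p b t =
  mk⇔ (λ s → let next , s′ = to T-∧ s in Sum.map (≡ᵇ⇒≡ b p) (≡ᵇ⇒≡ b (suc i)) (to T-∨ next) , s′)
      (λ (next , s′) → from T-∧ (from T-∨ (Sum.map (≡⇒≡ᵇ b p) (≡⇒≡ᵇ b (suc i)) next) , s′))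

-- fubiniAfter f γ: every entry a of γ satisfies the Fubini condition when f a further
-- entries below a precede γ.
fubiniAfter : (ℕ → ℕ) → List ℕ → Bool
fubiniAfter f γ = all (λ a → a ≡ᵇ suc (f a + countBelow γ a)) γ

extendCount : (ℕ → ℕ) → ℕ → ℕ → ℕ
extendCount f b a = f a + countBelow (b ∷ []) a

fubiniAfter-∷ : ∀ f b γ → T (weaklyIncreasing (b ∷ γ)) →
                fubiniAfter f (b ∷ γ) ≡ (b ≡ᵇ suc (f b)) ∧ fubiniAfter (extendCount f b) γ
fubiniAfter-∷ f b γ w = cong₂ _∧_ head (cong and (map-cong tail γ))
  where
  head : (b ≡ᵇ suc (f b + countBelow (b ∷ γ) b)) ≡ (b ≡ᵇ suc (f b))
  head = cong (λ c → b ≡ᵇ suc c)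
              (trans (cong (f b +_) (countBelow-none (b ∷ γ) (≤-refl ∷ weaklyIncreasing⇒head≤ b γ w)))
                     (+-identityʳ (f b)))
  tail : ∀ a → (a ≡ᵇ suc (f a + countBelow (b ∷ γ) a)) ≡ (a ≡ᵇ suc (extendCount f b a + countBelow γ a))
  tail a = cong (λ c → a ≡ᵇ suc c)
                (trans (cong (f a +_) (countBelow-∷ b γ a)) (sym (+-assoc (f a) _ _)))

-- f a counts the entries below a of a valid prefix with i entries, the last being p.
record FubiniPrefix (i p : ℕ) (f : ℕ → ℕ) : Set where
  field
    last≤length : p ≤ i
    below-above : ∀ {a} → p < a → f a ≡ i
    below-last  : suc (f p) ≡ p

module _ {i p f} (P : FubiniPrefix i p f) where
  open FubiniPrefix P

  nextEntry-fubini⇒ : ∀ {b} → p ≤ b → suc (f b) ≡ b → b ≡ p ⊎ b ≡ suc i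
  nextEntry-fubini⇒ p≤b fb with m≤n⇒m<n∨m≡n p≤b
  ... | inj₂ p≡b = inj₁ (sym p≡b)
  ... | inj₁ p<b = inj₂ (trans (sym fb) (cong suc (below-above p<b)))

  nextEntry-fubini⇐ : ∀ {b} → b ≡ p ⊎ b ≡ suc i → p ≤ b × suc (f b) ≡ b
  nextEntry-fubini⇐ (inj₁ refl) = ≤-refl , below-last
  nextEntry-fubini⇐ (inj₂ refl) = m≤n⇒m≤1+n last≤length , cong suc (below-above (s≤s last≤length))

  fubiniPrefix-∷ : ∀ {b} → b ≡ p ⊎ b ≡ suc i → FubiniPrefix (suc i) b (extendCount f b)
  fubiniPrefix-∷ {b} next = record
    { last≤length = b≤1+i next
    ; below-above = λ b<a → trans (cong₂ _+_ (below-above (≤-<-trans p≤b b<a)) (countBelow-[]-< b<a)) (+-comm i 1)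
    ; below-last  = trans (cong (λ c → suc (f b + c)) (countBelow-none (b ∷ []) (≤-refl ∷ [])))
                          (trans (cong suc (+-identityʳ (f b))) (proj₂ (nextEntry-fubini⇐ next)))
    }
    where
    p≤b : p ≤ b
    p≤b = proj₁ (nextEntry-fubini⇐ next)
    b≤1+i : b ≡ p ⊎ b ≡ suc i → b ≤ suc i
    b≤1+i (inj₁ refl) = m≤n⇒m≤1+n last≤length
    b≤1+i (inj₂ refl) = ≤-refl

fubiniPrefix-1 : FubiniPrefix 1 1 (extendCount (λ _ → 0) 1)
fubiniPrefix-1 = record { last≤length = ≤-refl ; below-above = countBelow-[]-< ; below-last = refl }

staircaseFrom⇒fubini : ∀ {i p f} γ → FubiniPrefix i p f → T (staircaseFrom i p γ) →
                       T (weaklyIncreasing (p ∷ γ)) × T (fubiniAfter f γ)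
staircaseFrom⇒fubini []      _ _ = _ , _
staircaseFrom⇒fubini {i} {p} {f} (b ∷ γ) P s
  with next , s′ ← to (T-staircaseFrom-∷ i p b γ) s
  with p≤b , fb ← nextEntry-fubini⇐ P next
  with w , φ ← staircaseFrom⇒fubini γ (fubiniPrefix-∷ P next) s′
  = from (T-weaklyIncreasing-∷ p b γ) (p≤b , w) ,
    subst T (sym (fubiniAfter-∷ f b γ w)) (from T-∧ (≡⇒≡ᵇ b (suc (f b)) (sym fb) , φ))

fubini⇒staircaseFrom : ∀ {i p f} γ → FubiniPrefix i p f → T (weaklyIncreasing (p ∷ γ)) →
                       T (fubiniAfter f γ) → T (staircaseFrom i p γ)
fubini⇒staircaseFrom []      _ _ _ = _
fubini⇒staircaseFrom {i} {p} {f} (b ∷ γ) P w φ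
  with p≤b , w′ ← to (T-weaklyIncreasing-∷ p b γ) w
  with fb , φ′ ← to T-∧ (subst T (fubiniAfter-∷ f b γ w′) φ)
  with next ← nextEntry-fubini⇒ P p≤b (sym (≡ᵇ⇒≡ b (suc (f b)) fb))
  = from (T-staircaseFrom-∷ i p b γ) (next , fubini⇒staircaseFrom γ (fubiniPrefix-∷ P next) w′ φ′)

fubini⇒staircase : ∀ α → T (weaklyIncreasing α ∧ isFubini α) → T (staircase α)
fubini⇒staircase []      _ = _
fubini⇒staircase (a ∷ t) wφ
  with w , φ ← to T-∧ wφ
  with a≡1 , φ′ ← to T-∧ (subst T (fubiniAfter-∷ (λ _ → 0) a t w) φ)
  with refl ← ≡ᵇ⇒≡ a 1 a≡1
  = fubini⇒staircaseFrom t fubiniPrefix-1 w φ′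

staircase⇒fubini : ∀ α → T (staircase α) → T (weaklyIncreasing α ∧ isFubini α)
staircase⇒fubini []      _ = _
staircase⇒fubini (a ∷ t) s
  with a≡1 , s′ ← to T-∧ s
  with refl ← ≡ᵇ⇒≡ a 1 a≡1
  with w , φ ← staircaseFrom⇒fubini t fubiniPrefix-1 s′
  = from T-∧ (w , subst T (sym (fubiniAfter-∷ (λ _ → 0) 1 t w)) φ)

weaklyIncreasingFubini≡staircase : ∀ α → (weaklyIncreasing α ∧ isFubini α) ≡ staircase α
weaklyIncreasingFubini≡staircase α = T-⇔⇒≡ (fubini⇒staircase α) (staircase⇒fubini α)

occupied-head : ∀ x occ → T (occupied (x ∷ occ) x)
occupied-head x occ = from T-∨ (inj₁ (≡⇒≡ᵇ x x refl))

occupied-there : ∀ {s} x occ → T (occupied occ s) → T (occupied (x ∷ occ) s)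
occupied-there x occ = from T-∨ ∘ inj₂

occupied-above : ∀ {i s occ} → All (_≤ i) occ → i < s → ¬ T (occupied occ s)
occupied-above {s = s} {x ∷ _} (x≤i ∷ occ≤i) i<s taken with to T-∨ taken
... | inj₁ s≡x  = <⇒≱ i<s (subst (_≤ _) (sym (≡ᵇ⇒≡ s x s≡x)) x≤i)
... | inj₂ rest = occupied-above occ≤i i<s rest

firstFree-≤ : ∀ {i} occ s fuel → All (_≤ i) occ → s ≤ suc i → firstFree occ s fuel ≤ suc i
firstFree-≤ occ s zero       _     s≤1+i = s≤1+i
firstFree-≤ occ s (suc fuel) occ≤i s≤1+i with occupied occ s in taken
... | false = s≤1+i
... | true with m≤n⇒m<n∨m≡n s≤1+i
...   | inj₁ s≤i  = firstFree-≤ occ (suc s) fuel occ≤i s≤i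
...   | inj₂ refl = contradiction (from T-≡ taken) (occupied-above occ≤i ≤-refl)

-- occ lists the spots taken by the first i cars and p is the preference of the i-th car.
record ParkingState (i p : ℕ) (occ : List ℕ) : Set where
  field
    1≤p        : 1 ≤ p
    p≤i        : p ≤ i
    occ≤i      : All (_≤ i) occ
    p-occupied : T (occupied occ p)

parkingState-repeat : ∀ {i p occ} fuel → ParkingState i p occ →
                      ParkingState (suc i) p (firstFree occ p fuel ∷ occ)
parkingState-repeat {p = p} {occ} fuel S = record
  { 1≤p        = 1≤p
  ; p≤i        = m≤n⇒m≤1+n p≤i
  ; occ≤i      = firstFree-≤ occ _ fuel occ≤i (m≤n⇒m≤1+n p≤i) ∷ All.map m≤n⇒m≤1+n occ≤i
  ; p-occupied = occupied-there {p} _ occ p-occupied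
  }
  where open ParkingState S

parkingState-new : ∀ {i occ} → All (_≤ i) occ → ParkingState (suc i) (suc i) (suc i ∷ occ)
parkingState-new {i} {occ} occ≤i = record
  { 1≤p        = s≤s z≤n
  ; p≤i        = ≤-refl
  ; occ≤i      = ≤-refl ∷ All.map m≤n⇒m≤1+n occ≤i
  ; p-occupied = occupied-head (suc i) occ
  }

module _ (m q : ℕ) where

  tailWeight : ℕ → ℕ → List ℕ → List ℕ → ℕ
  tailWeight i p occ t = if staircaseFrom i p t then q ^ luckyAux m occ t else 0

  rankingWeight : List ℕ → ℕ
  rankingWeight α = if staircase α then q ^ luckyAux m [] α else 0

  tailWeight-repeat : ∀ {i p occ} t → T (occupied occ p) →
                      tailWeight i p occ (p ∷ t) ≡ tailWeight (suc i) p (firstFree occ p m ∷ occ) t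
  tailWeight-repeat {p = p} t taken rewrite ≡ᵇ-refl p | to T-≡ taken = refl

  tailWeight-new : ∀ {i p occ} t → suc i ≢ p → ¬ T (occupied occ (suc i)) →
                   tailWeight i p occ (suc i ∷ t) ≡ q * tailWeight (suc i) (suc i) (suc i ∷ occ) t
  tailWeight-new {i} t 1+i≢p free
    rewrite ≢⇒≡ᵇ≡false 1+i≢p | ≡ᵇ-refl i | ¬T⇒≡false free
    with staircaseFrom (suc i) (suc i) t
  ... | true  = refl
  ... | false = sym (*-zeroʳ q)

  tailWeight-other : ∀ {i p occ b} t → b ≢ p → b ≢ suc i → tailWeight i p occ (b ∷ t) ≡ 0
  tailWeight-other t b≢p b≢1+i rewrite ≢⇒≡ᵇ≡false b≢p | ≢⇒≡ᵇ≡false b≢1+i = refl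

  rankingWeight-1∷ : ∀ t → rankingWeight (1 ∷ t) ≡ q * tailWeight 1 1 (1 ∷ []) t
  rankingWeight-1∷ t with staircaseFrom 1 1 t
  ... | true  = refl
  ... | false = sym (*-zeroʳ q)

  rankingWeight-other : ∀ {a} t → a ≢ 1 → rankingWeight (a ∷ t) ≡ 0
  rankingWeight-other t a≢1 rewrite ≢⇒≡ᵇ≡false a≢1 = refl

  sum-tailWeight : ∀ k {i p occ} → ParkingState i p occ → i + k ≤ m →
                   sum (map (tailWeight i p occ) (tuples m k)) ≡ (q + 1) ^ k
  sum-tailWeight zero    _ _ = refl
  sum-tailWeight (suc k) {i} {p} {occ} S i+1+k≤m = begin
    sum (map (tailWeight i p occ) (tuples m (suc k)))  ≡⟨ sum-map-tuples m k _ ⟩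
    sum (map fibre (range1 m))                         ≡⟨ sum-map-twoPoints (range1-unique m) p∈ 1+i∈ p≢1+i
                                                                              (λ _ → fibre-other) ⟩
    fibre p + fibre (suc i)                            ≡⟨ cong₂ _+_ fibre-repeat fibre-new ⟩
    (q + 1) ^ k + q * (q + 1) ^ k                      ≡⟨ cong (_* (q + 1) ^ k) (+-comm 1 q) ⟩
    (q + 1) ^ suc k                                    ∎
    where
    open ≡-Reasoning
    open ParkingState S

    fibre : ℕ → ℕ
    fibre b = sum (map (tailWeight i p occ ∘ (b ∷_)) (tuples m k))

    1+i+k≤m : suc i + k ≤ m
    1+i+k≤m = subst (_≤ m) (+-suc i k) i+1+k≤m

    1+i≤m : suc i ≤ m
    1+i≤m = m+n≤o⇒m≤o (suc i) 1+i+k≤m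

    p≢1+i : p ≢ suc i
    p≢1+i = <⇒≢ (s≤s p≤i)

    p∈ : p ∈ range1 m
    p∈ = ∈-range1 1≤p (≤-trans p≤i (<⇒≤ 1+i≤m))

    1+i∈ : suc i ∈ range1 m
    1+i∈ = ∈-range1 (s≤s z≤n) 1+i≤m

    fibre-repeat : fibre p ≡ (q + 1) ^ k
    fibre-repeat = trans (cong sum (map-cong (λ t → tailWeight-repeat t p-occupied) (tuples m k)))
                         (sum-tailWeight k (parkingState-repeat m S) 1+i+k≤m)

    fibre-new : fibre (suc i) ≡ q * (q + 1) ^ k
    fibre-new = begin
      fibre (suc i)
        ≡⟨ cong sum (map-cong (λ t → tailWeight-new t (≢-sym p≢1+i) (occupied-above occ≤i ≤-refl)) (tuples m k)) ⟩
      sum (map (λ t → q * tailWeight (suc i) (suc i) (suc i ∷ occ) t) (tuples m k))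
        ≡⟨ sum-map-*ˡ q _ (tuples m k) ⟩
      q * sum (map (tailWeight (suc i) (suc i) (suc i ∷ occ)) (tuples m k))
        ≡⟨ cong (q *_) (sum-tailWeight k (parkingState-new occ≤i) 1+i+k≤m) ⟩
      q * (q + 1) ^ k ∎

    fibre-other : ∀ {b} → b ≢ p → b ≢ suc i → fibre b ≡ 0
    fibre-other b≢p b≢1+i = sum-map-zero (All.universal (λ t → tailWeight-other {occ = occ} t b≢p b≢1+i) (tuples m k))

  sum-rankingWeight : ∀ n → suc n ≤ m → sum (map rankingWeight (tuples m (suc n))) ≡ q * (q + 1) ^ n
  sum-rankingWeight n 1+n≤m = begin
    sum (map rankingWeight (tuples m (suc n)))                  ≡⟨ sum-map-tuples m n _ ⟩
    sum (map fibre (range1 m))                                  ≡⟨ sum-map-onePoint (range1-unique m) 1∈ fibre-other ⟩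
    fibre 1                                                     ≡⟨ cong sum (map-cong rankingWeight-1∷ (tuples m n)) ⟩
    sum (map (λ t → q * tailWeight 1 1 (1 ∷ []) t) (tuples m n)) ≡⟨ sum-map-*ˡ q _ (tuples m n) ⟩
    q * sum (map (tailWeight 1 1 (1 ∷ [])) (tuples m n))         ≡⟨ cong (q *_) (sum-tailWeight n (parkingState-new []) 1+n≤m) ⟩
    q * (q + 1) ^ n                                             ∎
    where
    open ≡-Reasoning

    fibre : ℕ → ℕ
    fibre a = sum (map (rankingWeight ∘ (a ∷_)) (tuples m n))

    1∈ : 1 ∈ range1 m
    1∈ = ∈-range1 ≤-refl (m+n≤o⇒m≤o 1 1+n≤m)

    fibre-other : ∀ {a} → a ∈ range1 m → a ≢ 1 → fibre a ≡ 0
    fibre-other _ a≢1 = sum-map-zero (All.universal (λ t → rankingWeight-other t a≢1) (tuples m n))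

corollary2p15 : (∀ (n q : ℕ) → luckyPoly (suc n) q ≡ q * (q + 1) ^ n)
                × (∀ (q : ℕ) → luckyPoly 0 q ≡ 1)
corollary2p15 = luckyPoly-suc , λ _ → refl
  where
  luckyPoly-suc : ∀ n q → luckyPoly (suc n) q ≡ q * (q + 1) ^ n
  luckyPoly-suc n q = begin
    luckyPoly (suc n) q
      ≡⟨ sum-map-filter isRanking (λ α → q ^ lucky α) (tuples N N) ⟩
    sum (map (λ α → if isRanking α then q ^ lucky α else 0) (tuples N N))
      ≡⟨ cong sum (map-cong-local (All.map (λ {α} → weight≡ α) (tuples-length N N))) ⟩
    sum (map (rankingWeight N q) (tuples N N))
      ≡⟨ sum-rankingWeight N q n ≤-refl ⟩
    q * (q + 1) ^ n ∎
    where
    open ≡-Reasoning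
    N : ℕ
    N = suc n
    isRanking : List ℕ → Bool
    isRanking α = weaklyIncreasing α ∧ isFubini α
    weight≡ : ∀ α → length α ≡ N → (if isRanking α then q ^ lucky α else 0) ≡ rankingWeight N q α
    weight≡ α len = cong₂ (λ b l → if b then q ^ luckyAux l [] α else 0) (weaklyIncreasingFubini≡staircase α) len
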